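{- Let $\langle X,\tau^0,\tau^1\rangle$ be a bitopological space in which both $\tau^0$ and $\tau^1$ are Alexandroff. The following are equivalent: (1) $\langle X,\tau^0,\tau^1\rangle$ is an $\mathbf{IL}$-space; (2) $\langle X,\tau^0\rangle$ is scattered and there exists an Alexandroff topology $\tau^2$ on $X$ such that $\tau^0\cap\tau^1\subseteq\tau^2\subseteq\tau^0$ and $\mathrm{Log}(X,\tau^0,\tau^1)=\mathrm{Log}(X,\tau^0,\tau^2)$; (3) there exists a Visser frame $\langle X,R,S\rangle$ such that $R\subseteq S$ and $\mathrm{Log}(X,\tau^0,\tau^1)=\mathrm{Log}(X,R,S)$.
   Context: $\mathcal{L}(\Box,\rhd)$ has propositional variables, $\top,\bot$, $\neg,\land,\lor,\to$, unary $\Box,\Diamond$ ($\Diamond$ dual of $\Box$) and binary $\rhd$. $\mathbf{IL}$ is the smallest set of formulas containing all propositional tautologies, $\Box(p\to q)\to(\Box p\to\Box q)$, $\Box(\Box p\to p)\to\Box p$, J1: $\Box(p\to q)\to(p\rhd q)$; J2: $(p\rhd q)\land(q\rhd r)\to(p\rhd r)$; J3: $(p\rhd r)\land(q\rhd r)\to((p\lor q)\rhd r)$; J4: $(p\rhd q)\to(\Diamond p\to\Diamond q)$; J5: $\Diamond p\rhd p$, closed under modus ponens, necessitation and substitution. For a topology $\tau$, $d_\tau(Y)=\{x: \text{every } U\in\tau \text{ containing } x \text{ meets } Y\setminus\{x\}\}$, $cd_\tau(Y)=X\setminus d_\tau(X\setminus Y)$; scattered means $Y\setminus d_\tau(Y)\neq\varnothing$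 for all nonempty $Y$; Alexandroff means closed under arbitrary intersections. A bitopological space is $\langle X,\tau^0,\tau^1\rangle$ with $X\neq\varnothing$, $\tau^0,\tau^1$ topologies. $e_{\tau^0,\tau^1}(Y,Z)=\{x:\forall U\in\tau^1[x\in d_{\tau^0}(Y\cap U)\Rightarrow x\in d_{\tau^0}(Z\cap U)]\}$. A valuation $v$ maps formulas to subsets of $X$, Boolean on connectives, with $v(\Box\varphi)=cd_{\tau^0}(v(\varphi))$, $v(\Diamond\varphi)=d_{\tau^0}(v(\varphi))$, $v(\varphi\rhd\psi)=e_{\tau^0,\tau^1}(v(\varphi),v(\psi))$; $\mathrm{Log}(X,\tau^0,\tau^1)$ is the set of $\varphi$ with $v(\varphi)=X$ for all $v$; an $\mathbf{IL}$-space has $\mathbf{IL}\subseteq\mathrm{Log}(X,\tau^0,\tau^1)$. A Visser frame is $\langle W,R,S\rangle$ with $W\ne\varnothing$, $R$ transitive and conversely well-founded (no infinite $R$-increasing sequence), $S$ transitive and reflexive. A Visser model adds $\Vdash$ with Boolean clauses, $x\Vdash\Box\varphi$ iff $\forall y(xRy\Rightarrow y\Vdash\varphi)$, $x\Vdash\Diamond\varphi$ iff $\exists y(xRy\wedge y\Vdash\varphi)$, $x\Vdash\varphi\rhd\psi$ iff for all $y$ with $xRy$, $y\Vdash\varphi$ there is $z$ with $xRz$, $ySz$, $z\Vdash\psi$. $\mathrm{Log}(W,R,S)$ is the set of formulas true at all points of all Visser models on the frame. -}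

module Defs where

open import Level using (Level; 0ℓ) renaming (suc to lsuc)
open import Data.Nat using (ℕ; suc)
open import Data.Bool using (Bool; true; false; not; _∧_; _∨_)
open import Data.Unit using (⊤)
open import Data.Empty using (⊥)
open import Data.Product using (Σ; _×_; _,_)
open import Data.Sum using (_⊎_)
open import Relation.Nullary using (¬_)
open import Relation.Binary.PropositionalEquality using (_≡_)

infixr 6 _⋀_
infixr 5 _⋁_
infixr 4 _⇒_
infix  7 _▷_

data Formula : Set where
  var  : ℕ → Formula
  ⊤'   : Formula
  ⊥'   : Formula
  ¬'   : Formula → Formula
  _⋀_  : Formula → Formula → Formula
  _⋁_  : Formula → Formula → Formula
  _⇒_  : Formula → Formula → Formula
  □    : Formula → Formula
  ◇    : Formula → Formula
  _▷_  : Formula → Formula → Formula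

sub : (ℕ → Formula) → Formula → Formula
sub σ (var n) = σ n
sub σ ⊤' = ⊤'
sub σ ⊥' = ⊥'
sub σ (¬' φ) = ¬' (sub σ φ)
sub σ (φ ⋀ ψ) = sub σ φ ⋀ sub σ ψ
sub σ (φ ⋁ ψ) = sub σ φ ⋁ sub σ ψ
sub σ (φ ⇒ ψ) = sub σ φ ⇒ sub σ ψ
sub σ (□ φ) = □ (sub σ φ)
sub σ (◇ φ) = ◇ (sub σ φ)
sub σ (φ ▷ ψ) = sub σ φ ▷ sub σ ψ

-- Propositional tautologies: true under every Boolean assignment in which
-- variables and modal formulas (□φ, ◇φ, φ▷ψ) are treated as atoms.
bval : (Formula → Bool) → Formula → Bool
bval ρ (var n) = ρ (var n)
bval ρ ⊤' = true
bval ρ ⊥' = false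
bval ρ (¬' φ) = not (bval ρ φ)
bval ρ (φ ⋀ ψ) = bval ρ φ ∧ bval ρ ψ
bval ρ (φ ⋁ ψ) = bval ρ φ ∨ bval ρ ψ
bval ρ (φ ⇒ ψ) = not (bval ρ φ) ∨ bval ρ ψ
bval ρ (□ φ) = ρ (□ φ)
bval ρ (◇ φ) = ρ (◇ φ)
bval ρ (φ ▷ ψ) = ρ (φ ▷ ψ)

Tautology : Formula → Set
Tautology φ = (ρ : Formula → Bool) → bval ρ φ ≡ true

p q r : Formula
p = var 0
q = var 1
r = var 2

data IL : Formula → Set where
  taut : ∀ {φ} → Tautology φ → IL φ
  axK  : IL (□ (p ⇒ q) ⇒ (□ p ⇒ □ q))
  axL  : IL (□ (□ p ⇒ p) ⇒ □ p)
  axJ1 : IL (□ (p ⇒ q) ⇒ (p ▷ q))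
  axJ2 : IL ((p ▷ q) ⋀ (q ▷ r) ⇒ (p ▷ r))
  axJ3 : IL ((p ▷ r) ⋀ (q ▷ r) ⇒ ((p ⋁ q) ▷ r))
  axJ4 : IL ((p ▷ q) ⇒ (◇ p ⇒ ◇ q))
  axJ5 : IL (◇ p ▷ p)
  mp   : ∀ {φ ψ} → IL (φ ⇒ ψ) → IL φ → IL ψ
  nec  : ∀ {φ} → IL φ → IL (□ φ)
  subst : ∀ {φ} (σ : ℕ → Formula) → IL φ → IL (sub σ φ)

_≐ᴸ_ : (Formula → Set₁) → (Formula → Set₁) → Set₁
L ≐ᴸ L' = ∀ φ → (L φ → L' φ) × (L' φ → L φ)

module _ {X : Set} where

  Subset : Set₁
  Subset = X → Set

  _≐_ : Subset → Subset → Set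
  U ≐ V = ∀ x → (U x → V x) × (V x → U x)

  -- A collection of subsets is given as a Set-indexed family (predicative
  -- rendering of a set of subsets).
  record Topology : Set₁ where
    field
      Idx  : Set
      Open : Idx → Subset
      open-full : Σ Idx (λ i → Open i ≐ (λ _ → ⊤))
      open-∩    : ∀ i j → Σ Idx (λ k → Open k ≐ (λ x → Open i x × Open j x))
      open-⋃    : (𝒰 : Idx → Set) →
                  Σ Idx (λ k → Open k ≐ (λ x → Σ Idx (λ i → 𝒰 i × Open i x)))

  open Topology public

  _∈τ_ : Subset → Topology → Set
  U ∈τ τ = Σ (Idx τ) (λ i → Open τ i ≐ U)

  IsAlexandroff : Topology → Set₁
  IsAlexandroff τ = (𝒰 : Idx τ → Set) →
    (λ x → ∀ i → 𝒰 i → Open τ i x) ∈τ τ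

  d : Topology → Subset → Subset
  d τ Y x = ∀ i → Open τ i x → Σ X (λ y → Open τ i y × Y y × ¬ (y ≡ x))

  cd : Topology → Subset → Subset
  cd τ Y x = ¬ d τ (λ y → ¬ Y y) x

  Scattered : Topology → Set₁
  Scattered τ = (Y : Subset) → Σ X Y → Σ X (λ x → Y x × ¬ d τ Y x)

  e : Topology → Topology → Subset → Subset → Subset
  e τ0 τ1 Y Z x = ∀ j → d τ0 (λ y → Y y × Open τ1 j y) x →
                        d τ0 (λ y → Z y × Open τ1 j y) x

  ⟦_⟧ : Formula → Topology → Topology → (ℕ → Subset) → Subset
  ⟦ var n ⟧ τ0 τ1 V = V n
  ⟦ ⊤' ⟧ τ0 τ1 V = λ _ → ⊤
  ⟦ ⊥' ⟧ τ0 τ1 V = λ _ → ⊥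
  ⟦ ¬' φ ⟧ τ0 τ1 V = λ x → ¬ ⟦ φ ⟧ τ0 τ1 V x
  ⟦ φ ⋀ ψ ⟧ τ0 τ1 V = λ x → ⟦ φ ⟧ τ0 τ1 V x × ⟦ ψ ⟧ τ0 τ1 V x
  ⟦ φ ⋁ ψ ⟧ τ0 τ1 V = λ x → ⟦ φ ⟧ τ0 τ1 V x ⊎ ⟦ ψ ⟧ τ0 τ1 V x
  ⟦ φ ⇒ ψ ⟧ τ0 τ1 V = λ x → ⟦ φ ⟧ τ0 τ1 V x → ⟦ ψ ⟧ τ0 τ1 V x
  ⟦ □ φ ⟧ τ0 τ1 V = cd τ0 (⟦ φ ⟧ τ0 τ1 V)
  ⟦ ◇ φ ⟧ τ0 τ1 V = d τ0 (⟦ φ ⟧ τ0 τ1 V)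
  ⟦ φ ▷ ψ ⟧ τ0 τ1 V = e τ0 τ1 (⟦ φ ⟧ τ0 τ1 V) (⟦ ψ ⟧ τ0 τ1 V)

  TopLog : Topology → Topology → Formula → Set₁
  TopLog τ0 τ1 φ = (V : ℕ → Subset) → ∀ x → ⟦ φ ⟧ τ0 τ1 V x

  IsILSpace : Topology → Topology → Set₁
  IsILSpace τ0 τ1 = ∀ φ → IL φ → TopLog τ0 τ1 φ

  record IsVisserFrame (R S : X → X → Set) : Set where
    field
      R-trans : ∀ {x y z} → R x y → R y z → R x z
      R-cwf   : ¬ Σ (ℕ → X) (λ f → ∀ n → R (f n) (f (suc n)))
      S-refl  : ∀ x → S x x
      S-trans : ∀ {x y z} → S x y → S y z → S x z

  _,_,_⊩_at_ : (R S : X → X → Set) → (ℕ → Subset) → Formula → X → Set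
  (R , S , V ⊩ var n at x) = V n x
  (R , S , V ⊩ ⊤' at x) = ⊤
  (R , S , V ⊩ ⊥' at x) = ⊥
  (R , S , V ⊩ ¬' φ at x) = ¬ (R , S , V ⊩ φ at x)
  (R , S , V ⊩ φ ⋀ ψ at x) = (R , S , V ⊩ φ at x) × (R , S , V ⊩ ψ at x)
  (R , S , V ⊩ φ ⋁ ψ at x) = (R , S , V ⊩ φ at x) ⊎ (R , S , V ⊩ ψ at x)
  (R , S , V ⊩ φ ⇒ ψ at x) = (R , S , V ⊩ φ at x) → (R , S , V ⊩ ψ at x)
  (R , S , V ⊩ □ φ at x) = ∀ y → R x y → R , S , V ⊩ φ at y
  (R , S , V ⊩ ◇ φ at x) = Σ X (λ y → R x y × (R , S , V ⊩ φ at y))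
  (R , S , V ⊩ φ ▷ ψ at x) =
    ∀ y → R x y → (R , S , V ⊩ φ at y) →
    Σ X (λ z → R x z × S y z × (R , S , V ⊩ ψ at z))

  FrameLog : (R S : X → X → Set) → Formula → Set₁
  FrameLog R S φ = (V : ℕ → Subset) → ∀ x → R , S , V ⊩ φ at x

-- On an Alexandroff space the derived set d_τ0 Y is the set of points with a strict
-- specialisation successor in Y, so (classically) the semantics over ⟨X, τ0, τ1⟩ is the
-- Visser-style semantics with R = <₀ and S = ≤₁; scatteredness of τ0 says exactly that <₀ is
-- conversely well-founded, and it follows from validity of Löb's axiom.  As ▷ at x compares S
-- only on R-successors of x, S may be altered freely elsewhere.  Validity of J5 gives y ≤₁ w
-- whenever x <₀ y <₀ w, so the preorder generated by <₀ and ≤₁ restricted to R-siblings still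
-- agrees with ≤₁ on siblings: it is the S of (3), and it is the specialisation order of τ2, the
-- topology of τ0-open sets upward closed under it.  The converse implications are soundness of
-- IL on Visser frames with R ⊆ S.

{-# OPTIONS --safe #-}
module Submission where

open import Defs
open import Level using (0ℓ) renaming (suc to lsuc)
open import Axiom.ExcludedMiddle using (ExcludedMiddle)
open import Axiom.DoubleNegationElimination using (em⇒dne)
open import Data.Bool using (Bool; true; false; not; _∨_; T)
open import Data.Bool.Properties using (T-≡; T-∧; T-∨)
open import Data.Nat using (ℕ; zero; suc)
open import Data.Product using (Σ; _×_; _,_; proj₁; proj₂)
open import Data.Product.Function.NonDependent.Propositional using (_×-⇔_)
open import Data.Sum using (inj₁; inj₂)
open import Data.Sum.Function.Propositional using (_⊎-⇔_)
open import Data.Unit using (tt)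
open import Function using (_∘_; _⇔_; mk⇔; Equivalence)
open import Function.Construct.Composition using (_⇔-∘_)
open import Function.Construct.Identity using (⇔-id)
open import Function.Related.TypeIsomorphisms using (→-cong-⇔; ¬-cong-⇔)
open import Relation.Binary.Core using (Rel)
open import Relation.Binary.Definitions using (Transitive)
open import Relation.Binary.Construct.Closure.ReflexiveTransitive using (Star; ε; _◅_; _◅◅_; fold)
open import Relation.Binary.PropositionalEquality using (_≡_; refl)
open import Relation.Nullary using (¬_; yes; no)
open import Relation.Nullary.Decidable using (isYes; toWitness; fromWitness)

open Equivalence using (to; from)

≐ᴸ-sym : {L L′ : Formula → Set₁} → L ≐ᴸ L′ → L′ ≐ᴸ L
≐ᴸ-sym L≐L′ φ = proj₂ (L≐L′ φ) , proj₁ (L≐L′ φ)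

≐ᴸ-trans : {L L′ L″ : Formula → Set₁} → L ≐ᴸ L′ → L′ ≐ᴸ L″ → L ≐ᴸ L″
≐ᴸ-trans L≐L′ L′≐L″ φ = proj₁ (L′≐L″ φ) ∘ proj₁ (L≐L′ φ) , proj₂ (L≐L′ φ) ∘ proj₂ (L′≐L″ φ)

T-not : ∀ {b} → T (not b) ⇔ (¬ T b)
T-not {true}  = mk⇔ (λ ()) (λ ¬⊤ → ¬⊤ tt)
T-not {false} = mk⇔ (λ _ ()) (λ _ → tt)

T-implies : ∀ {b c} → T (not b ∨ c) ⇔ (T b → T c)
T-implies {true}  = mk⇔ (λ t _ → t) (λ f → f tt)
T-implies {false} = mk⇔ (λ _ ()) (λ _ → tt)

module _ {X : Set} where

  infix 4 _≤⟨_⟩_ _<⟨_⟩_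

  _≤⟨_⟩_ : X → Topology {X} → X → Set
  x ≤⟨ τ ⟩ y = ∀ i → Open τ i x → Open τ i y

  _<⟨_⟩_ : X → Topology {X} → X → Set
  x <⟨ τ ⟩ y = x ≤⟨ τ ⟩ y × ¬ (y ≡ x)

  ≤-refl : ∀ {τ} x → x ≤⟨ τ ⟩ x
  ≤-refl _ _ ix = ix

  ≤-trans : ∀ {τ} → Transitive (_≤⟨ τ ⟩_)
  ≤-trans x≤y y≤z i = y≤z i ∘ x≤y i

  UpClosed : Rel X 0ℓ → Subset {X} → Set
  UpClosed S U = ∀ {y z} → S y z → U y → U z

  ∈τ⇒UpClosed : ∀ {τ U} → U ∈τ τ → UpClosed (_≤⟨ τ ⟩_) U
  ∈τ⇒UpClosed {U = U} (i , i≐U) {y} {z} y≤z Uy = proj₁ (i≐U z) (y≤z i (proj₂ (i≐U y) Uy))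

  ≤-antitone : ∀ {τ τ′} → (∀ U → U ∈τ τ′ → U ∈τ τ) → ∀ {x y} → x ≤⟨ τ ⟩ y → x ≤⟨ τ′ ⟩ y
  ≤-antitone {τ} {τ′} τ′⊆τ x≤y j = ∈τ⇒UpClosed {τ} (τ′⊆τ (Open τ′ j) (j , λ _ → (λ o → o) , (λ o → o))) x≤y

  minimalOpen : ∀ {τ} → IsAlexandroff τ → ∀ x →
                Σ (Idx τ) (λ m → Open τ m x × (∀ z → Open τ m z → x ≤⟨ τ ⟩ z))
  minimalOpen {τ} A x =
    let m , m≐ = A (λ j → Open τ j x) in m , proj₂ (m≐ x) (λ _ o → o) , λ z o → proj₁ (m≐ z) o

  <⇒d : ∀ {τ Y x y} → x <⟨ τ ⟩ y → Y y → d τ Y x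
  <⇒d {y = y} (x≤y , y≢x) Yy i o = y , x≤y i o , Yy , y≢x

  d⇒< : ∀ {τ Y x} → IsAlexandroff τ → d τ Y x → Σ X (λ y → x <⟨ τ ⟩ y × Y y)
  d⇒< {τ} {x = x} A dYx =
    let m , m∋x , m⊆↑x = minimalOpen {τ} A x
        y , m∋y , Yy , y≢x = dYx m m∋x
    in y , (m⊆↑x y m∋y , y≢x) , Yy

  scattered⇒<-cwf : ∀ {τ} → Scattered τ → ¬ Σ (ℕ → X) (λ f → ∀ n → f n <⟨ τ ⟩ f (suc n))
  scattered⇒<-cwf {τ} sc (f , chain) with sc (λ y → Σ ℕ (λ n → f n ≡ y)) (f 0 , 0 , refl)
  ... | _ , (n , refl) , ¬dfn = ¬dfn (<⇒d {τ} (chain n) (suc n , refl))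

  scattered⇒<-trans : ∀ {τ} → Scattered τ → Transitive (_<⟨ τ ⟩_)
  scattered⇒<-trans {τ} sc {x} {y} {z} (x≤y , y≢x) (y≤z , z≢y) = ≤-trans {τ} x≤y y≤z , z≢x
    where
    z≢x : ¬ z ≡ x
    z≢x refl = scattered⇒<-cwf {τ} sc (alternate , chain)
      where
      alternate : ℕ → X
      alternate zero          = x
      alternate (suc zero)    = y
      alternate (suc (suc n)) = alternate n
      chain : ∀ n → alternate n <⟨ τ ⟩ alternate (suc n)
      chain zero          = x≤y , y≢x
      chain (suc zero)    = y≤z , z≢y
      chain (suc (suc n)) = chain n

  scattered⇒VisserFrame : ∀ {τ} {S : Rel X 0ℓ} → Scattered τ → (∀ x → S x x) → Transitive S →
                          IsVisserFrame (_<⟨ τ ⟩_) S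
  scattered⇒VisserFrame {τ} sc S-refl S-trans = record
    { R-trans = scattered⇒<-trans {τ} sc ; R-cwf = scattered⇒<-cwf {τ} sc ; S-refl = S-refl ; S-trans = S-trans }

  ▷-mono : ∀ {R S S′ : Rel X 0ℓ} {P P′ Q Q′ : Subset {X}} {x} →
           (∀ y → P′ y → P y) → (∀ {y z} → R x y → R x z → S y z → S′ y z) → (∀ z → Q z → Q′ z) →
           (∀ y → R x y → P y → Σ X (λ z → R x z × S y z × Q z)) →
           ∀ y → R x y → P′ y → Σ X (λ z → R x z × S′ y z × Q′ z)
  ▷-mono P′⊆P S⊆S′ Q⊆Q′ P▷Q y r p′ with P▷Q y r (P′⊆P y p′)
  ... | z , rz , s , q = z , rz , S⊆S′ r rz s , Q⊆Q′ z q

  module _ {R S S′ : Rel X 0ℓ} (agree : ∀ {x y z} → R x y → R x z → S y z ⇔ S′ y z) where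

    ⊩-cong-S : ∀ φ V x → (R , S , V ⊩ φ at x) ⇔ (R , S′ , V ⊩ φ at x)
    ⊩-cong-S (var n) V x = ⇔-id _
    ⊩-cong-S ⊤'      V x = ⇔-id _
    ⊩-cong-S ⊥'      V x = ⇔-id _
    ⊩-cong-S (¬' φ)  V x = ¬-cong-⇔ (⊩-cong-S φ V x)
    ⊩-cong-S (φ ⋀ ψ) V x = ⊩-cong-S φ V x ×-⇔ ⊩-cong-S ψ V x
    ⊩-cong-S (φ ⋁ ψ) V x = ⊩-cong-S φ V x ⊎-⇔ ⊩-cong-S ψ V x
    ⊩-cong-S (φ ⇒ ψ) V x = →-cong-⇔ (⊩-cong-S φ V x) (⊩-cong-S ψ V x)
    ⊩-cong-S (□ φ)   V x = mk⇔ (λ f y r → to (⊩-cong-S φ V y) (f y r))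
                               (λ f y r → from (⊩-cong-S φ V y) (f y r))
    ⊩-cong-S (◇ φ)   V x = mk⇔ (λ (y , r , f) → y , r , to (⊩-cong-S φ V y) f)
                               (λ (y , r , f) → y , r , from (⊩-cong-S φ V y) f)
    ⊩-cong-S (φ ▷ ψ) V x = mk⇔
      (▷-mono {R = R} {x = x} (λ y → from (⊩-cong-S φ V y)) (λ r rz → to (agree r rz)) (λ z → to (⊩-cong-S ψ V z)))
      (▷-mono {R = R} {x = x} (λ y → to (⊩-cong-S φ V y)) (λ r rz → from (agree r rz)) (λ z → from (⊩-cong-S ψ V z)))

    FrameLog-cong-S : FrameLog R S ≐ᴸ FrameLog R S′
    FrameLog-cong-S φ = (λ ⊩φ V x → to (⊩-cong-S φ V x) (⊩φ V x))
                      , (λ ⊩φ V x → from (⊩-cong-S φ V x) (⊩φ V x))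

  module _ {R S : Rel X 0ℓ} where

    ⊩-sub : ∀ σ φ V x → (R , S , V ⊩ sub σ φ at x) ⇔ (R , S , (λ n y → R , S , V ⊩ σ n at y) ⊩ φ at x)
    ⊩-sub σ (var n) V x = ⇔-id _
    ⊩-sub σ ⊤'      V x = ⇔-id _
    ⊩-sub σ ⊥'      V x = ⇔-id _
    ⊩-sub σ (¬' φ)  V x = ¬-cong-⇔ (⊩-sub σ φ V x)
    ⊩-sub σ (φ ⋀ ψ) V x = ⊩-sub σ φ V x ×-⇔ ⊩-sub σ ψ V x
    ⊩-sub σ (φ ⋁ ψ) V x = ⊩-sub σ φ V x ⊎-⇔ ⊩-sub σ ψ V x
    ⊩-sub σ (φ ⇒ ψ) V x = →-cong-⇔ (⊩-sub σ φ V x) (⊩-sub σ ψ V x)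
    ⊩-sub σ (□ φ)   V x = mk⇔ (λ f y r → to (⊩-sub σ φ V y) (f y r))
                              (λ f y r → from (⊩-sub σ φ V y) (f y r))
    ⊩-sub σ (◇ φ)   V x = mk⇔ (λ (y , r , f) → y , r , to (⊩-sub σ φ V y) f)
                              (λ (y , r , f) → y , r , from (⊩-sub σ φ V y) f)
    ⊩-sub σ (φ ▷ ψ) V x = mk⇔
      (▷-mono {R = R} {S = S} {x = x} (λ y → from (⊩-sub σ φ V y)) (λ _ _ s → s) (λ z → to (⊩-sub σ ψ V z)))
      (▷-mono {R = R} {S = S} {x = x} (λ y → to (⊩-sub σ φ V y)) (λ _ _ s → s) (λ z → from (⊩-sub σ ψ V z)))

  J5-valid⇒R⊆S-on-successors : ∀ {R S : Rel X 0ℓ} → FrameLog R S (◇ p ▷ p) →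
                                ∀ {x y w} → R x y → R y w → S y w
  J5-valid⇒R⊆S-on-successors J5 {x} {y} {w} xRy yRw with J5 (λ _ u → u ≡ w) x y xRy (w , yRw , refl)
  ... | _ , _ , Syw , refl = Syw

  module _ (em : ExcludedMiddle 0ℓ) where

    private
      dne : {P : Set} → ¬ ¬ P → P
      dne = em⇒dne em

    ¬∀⇒∃¬ : {A B : Subset {X}} → ¬ (∀ z → A z → B z) → Σ X (λ z → A z × ¬ B z)
    ¬∀⇒∃¬ ¬A⊆B = dne λ ¬∃ → ¬A⊆B λ z Az → dne λ ¬Bz → ¬∃ (z , Az , ¬Bz)

    conversely-wf-induction : {R : Rel X 0ℓ} → ¬ Σ (ℕ → X) (λ f → ∀ n → R (f n) (f (suc n))) →
                              (P : Subset {X}) → (∀ y → (∀ z → R y z → P z) → P y) → ∀ y → P y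
    conversely-wf-induction {R} cwf P step y = dne λ ¬Py → cwf (descent (y , ¬Py))
      where
      Counterexample : Set
      Counterexample = Σ X (¬_ ∘ P)

      next : (c : Counterexample) → Σ Counterexample (λ c′ → R (proj₁ c) (proj₁ c′))
      next (y , ¬Py) = let z , Ryz , ¬Pz = ¬∀⇒∃¬ (¬Py ∘ step y) in (z , ¬Pz) , Ryz

      descent : Counterexample → Σ (ℕ → X) (λ f → ∀ n → R (f n) (f (suc n)))
      descent c = proj₁ ∘ iterate , proj₂ ∘ next ∘ iterate
        where
        iterate : ℕ → Counterexample
        iterate zero    = c
        iterate (suc n) = proj₁ (next (iterate n))

    L-valid⇒R-maximal : ∀ {R S : Rel X 0ℓ} → FrameLog R S (□ (□ p ⇒ p) ⇒ □ p) →
                        (Y : Subset {X}) → Σ X Y → Σ X (λ x → Y x × ¬ Σ X (λ y → R x y × Y y))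
    L-valid⇒R-maximal {R} L Y (y₀ , Yy₀) = dne λ ¬max →
      let ascend : ∀ x → Y x → Σ X (λ y → R x y × Y y)
          ascend x Yx = dne λ ¬up → ¬max (x , Yx , ¬up)
          z , y₀Rz , Yz = ascend y₀ Yy₀
      in L (λ _ y → ¬ Y y) y₀ (λ x _ □¬Y Yx → let y , xRy , Yy = ascend x Yx in □¬Y y xRy Yy) z y₀Rz Yz

    module _ {R S : Rel X 0ℓ} (visser : IsVisserFrame R S) (R⊆S : ∀ x y → R x y → S x y) where
      open IsVisserFrame visser

      private
        truth : (ℕ → Subset {X}) → X → Formula → Bool
        truth V x ψ = isYes (em {R , S , V ⊩ ψ at x})

      T-bval-truth : ∀ V x φ → T (bval (truth V x) φ) ⇔ (R , S , V ⊩ φ at x)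
      T-bval-truth V x (var n) = mk⇔ toWitness fromWitness
      T-bval-truth V x ⊤'      = ⇔-id _
      T-bval-truth V x ⊥'      = ⇔-id _
      T-bval-truth V x (¬' φ)  = ¬-cong-⇔ (T-bval-truth V x φ) ⇔-∘ T-not
      T-bval-truth V x (φ ⋀ ψ) = (T-bval-truth V x φ ×-⇔ T-bval-truth V x ψ) ⇔-∘ T-∧
      T-bval-truth V x (φ ⋁ ψ) = (T-bval-truth V x φ ⊎-⇔ T-bval-truth V x ψ) ⇔-∘ T-∨
      T-bval-truth V x (φ ⇒ ψ) = →-cong-⇔ (T-bval-truth V x φ) (T-bval-truth V x ψ) ⇔-∘ T-implies
      T-bval-truth V x (□ φ)   = mk⇔ toWitness fromWitness
      T-bval-truth V x (◇ φ)   = mk⇔ toWitness fromWitness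
      T-bval-truth V x (φ ▷ ψ) = mk⇔ toWitness fromWitness

      IL-sound : ∀ {φ} → IL φ → FrameLog R S φ
      IL-sound {φ} (taut t) V x = to (T-bval-truth V x φ) (from T-≡ (t (truth V x)))
      IL-sound axK  V x □p⇒q □p y xRy = □p⇒q y xRy (□p y xRy)
      IL-sound axL  V x □[□p⇒p] y xRy =
        conversely-wf-induction R-cwf (λ y → R x y → V 0 y)
          (λ y ih xRy → □[□p⇒p] y xRy λ z yRz → ih z yRz (R-trans xRy yRz)) y xRy
      IL-sound axJ1 V x □p⇒q y xRy py = y , xRy , S-refl y , □p⇒q y xRy py
      IL-sound axJ2 V x (p▷q , q▷r) y xRy py =
        let z , xRz , ySz , qz = p▷q y xRy py
            w , xRw , zSw , rw = q▷r z xRz qz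
        in w , xRw , S-trans ySz zSw , rw
      IL-sound axJ3 V x (p▷r , q▷r) y xRy (inj₁ py) = p▷r y xRy py
      IL-sound axJ3 V x (p▷r , q▷r) y xRy (inj₂ qy) = q▷r y xRy qy
      IL-sound axJ4 V x p▷q (y , xRy , py) = let z , xRz , _ , qz = p▷q y xRy py in z , xRz , qz
      IL-sound axJ5 V x y xRy (w , yRw , pw) = w , R-trans xRy yRw , R⊆S y w yRw , pw
      IL-sound (mp ⊢φ⇒ψ ⊢φ) V x = IL-sound ⊢φ⇒ψ V x (IL-sound ⊢φ V x)
      IL-sound (nec ⊢φ) V x y _ = IL-sound ⊢φ V y
      IL-sound (subst {φ} σ ⊢φ) V x = from (⊩-sub σ φ V x) (IL-sound ⊢φ _ x)

    module _ {τ0 τ1 : Topology {X}} (A0 : IsAlexandroff τ0) (A1 : IsAlexandroff τ1) where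

      ⟦⟧⇔⊩ : ∀ φ V x → ⟦ φ ⟧ τ0 τ1 V x ⇔ (_<⟨ τ0 ⟩_ , _≤⟨ τ1 ⟩_ , V ⊩ φ at x)
      ⟦⟧⇔⊩ (var n) V x = ⇔-id _
      ⟦⟧⇔⊩ ⊤'      V x = ⇔-id _
      ⟦⟧⇔⊩ ⊥'      V x = ⇔-id _
      ⟦⟧⇔⊩ (¬' φ)  V x = ¬-cong-⇔ (⟦⟧⇔⊩ φ V x)
      ⟦⟧⇔⊩ (φ ⋀ ψ) V x = ⟦⟧⇔⊩ φ V x ×-⇔ ⟦⟧⇔⊩ ψ V x
      ⟦⟧⇔⊩ (φ ⋁ ψ) V x = ⟦⟧⇔⊩ φ V x ⊎-⇔ ⟦⟧⇔⊩ ψ V x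
      ⟦⟧⇔⊩ (φ ⇒ ψ) V x = →-cong-⇔ (⟦⟧⇔⊩ φ V x) (⟦⟧⇔⊩ ψ V x)
      ⟦⟧⇔⊩ (□ φ)   V x = mk⇔
        (λ □φ y x<y → to (⟦⟧⇔⊩ φ V y) (dne λ ¬φy → □φ (<⇒d {τ0} x<y ¬φy)))
        (λ ⊩□φ d¬φ → let y , x<y , ¬φy = d⇒< {τ0} A0 d¬φ in ¬φy (from (⟦⟧⇔⊩ φ V y) (⊩□φ y x<y)))
      ⟦⟧⇔⊩ (◇ φ)   V x = mk⇔
        (λ ◇φ → let y , x<y , φy = d⇒< {τ0} A0 ◇φ in y , x<y , to (⟦⟧⇔⊩ φ V y) φy)
        (λ (y , x<y , ⊩φ) → <⇒d {τ0} x<y (from (⟦⟧⇔⊩ φ V y) ⊩φ))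
      ⟦⟧⇔⊩ (φ ▷ ψ) V x = mk⇔ forth back
        where
        forth : ⟦ φ ▷ ψ ⟧ τ0 τ1 V x → (_<⟨ τ0 ⟩_ , _≤⟨ τ1 ⟩_ , V ⊩ φ ▷ ψ at x)
        forth φ▷ψ y x<y ⊩φ =
          let m , m∋y , m⊆↑y = minimalOpen {τ1} A1 y
              z , x<z , ψz , m∋z = d⇒< {τ0} A0 (φ▷ψ m (<⇒d {τ0} x<y (from (⟦⟧⇔⊩ φ V y) ⊩φ , m∋y)))
          in z , x<z , m⊆↑y z m∋z , to (⟦⟧⇔⊩ ψ V z) ψz
        back : (_<⟨ τ0 ⟩_ , _≤⟨ τ1 ⟩_ , V ⊩ φ ▷ ψ at x) → ⟦ φ ▷ ψ ⟧ τ0 τ1 V x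
        back ⊩φ▷ψ j dφ =
          let y , x<y , φy , j∋y = d⇒< {τ0} A0 dφ
              z , x<z , y≤z , ⊩ψ = ⊩φ▷ψ y x<y (to (⟦⟧⇔⊩ φ V y) φy)
          in <⇒d {τ0} x<z (from (⟦⟧⇔⊩ ψ V z) ⊩ψ , y≤z j j∋y)

      TopLog≐FrameLog : TopLog τ0 τ1 ≐ᴸ FrameLog (_<⟨ τ0 ⟩_) (_≤⟨ τ1 ⟩_)
      TopLog≐FrameLog φ = (λ ⊨φ V x → to (⟦⟧⇔⊩ φ V x) (⊨φ V x))
                        , (λ ⊩φ V x → from (⟦⟧⇔⊩ φ V x) (⊩φ V x))

  UpClosed-≐ : ∀ {S U V} → U ≐ V → UpClosed S V → UpClosed S U
  UpClosed-≐ U≐V upV {y} {z} Syz Uy = proj₂ (U≐V z) (upV Syz (proj₁ (U≐V y) Uy))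

  UpClosed-Star : ∀ {T U} → UpClosed T U → UpClosed (Star T) U
  UpClosed-Star {T} {U} upT = fold (λ y z → U y → U z) (λ Tyz Uz⇒Uw → Uz⇒Uw ∘ upT Tyz) (λ Uy → Uy)

  upClosedOpens : Topology {X} → Rel X 0ℓ → Topology {X}
  upClosedOpens τ S = record
    { Idx       = Idx′
    ; Open      = λ k → Open τ (proj₁ k)
    ; open-full = let i , i≐X = open-full τ in (i , UpClosed-≐ {S} i≐X (λ _ _ → tt)) , i≐X
    ; open-∩    = λ (i , upᵢ) (j , upⱼ) → let k , k≐ = open-∩ τ i j
                    in (k , UpClosed-≐ k≐ (λ Syz (iy , jy) → upᵢ Syz iy , upⱼ Syz jy)) , k≐
    ; open-⋃    = ⋃
    }
    where
    Idx′ : Set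
    Idx′ = Σ (Idx τ) (λ i → UpClosed S (Open τ i))

    ⋃ : (𝒰 : Idx′ → Set) → Σ Idx′ (λ k → Open τ (proj₁ k) ≐ (λ x → Σ Idx′ (λ i → 𝒰 i × Open τ (proj₁ i) x)))
    ⋃ 𝒰 with open-⋃ τ (λ i → Σ (UpClosed S (Open τ i)) (λ upᵢ → 𝒰 (i , upᵢ)))
    ... | k , k≐ = (k , UpClosed-≐ k≐ (λ Syz (i , (upᵢ , 𝒰i) , iy) → i , (upᵢ , 𝒰i) , upᵢ Syz iy))
                 , λ x → (λ kx → let i , (upᵢ , 𝒰i) , ix = proj₁ (k≐ x) kx in (i , upᵢ) , 𝒰i , ix)
                       , (λ ((i , upᵢ) , 𝒰i , ix) → proj₂ (k≐ x) (i , (upᵢ , 𝒰i) , ix))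

  module _ {τ : Topology {X}} {S : Rel X 0ℓ} (A : IsAlexandroff τ) where

    upClosedOpens-Alexandroff : IsAlexandroff (upClosedOpens τ S)
    upClosedOpens-Alexandroff 𝒰 with A (λ i → Σ (UpClosed S (Open τ i)) (λ upᵢ → 𝒰 (i , upᵢ)))
    ... | k , k≐ = (k , UpClosed-≐ k≐ (λ Syz ⋂y i (upᵢ , 𝒰i) → upᵢ Syz (⋂y i (upᵢ , 𝒰i))))
                 , λ x → (λ kx (i , upᵢ) 𝒰i → proj₁ (k≐ x) kx i (upᵢ , 𝒰i))
                       , (λ ⋂x → proj₂ (k≐ x) λ i (upᵢ , 𝒰i) → ⋂x (i , upᵢ) 𝒰i)

    module _ (S-trans : Transitive S) (≤⊆S : ∀ {x y} → x ≤⟨ τ ⟩ y → S x y) where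

      upset-∈τ : ∀ x → S x ∈τ τ
      upset-∈τ x with open-⋃ τ (λ i → ∀ y → Open τ i y → S x y)
      ... | k , k≐ = k , λ y → (λ ky → let i , i⊆↑x , iy = proj₁ (k≐ y) ky in i⊆↑x y iy)
                             , (λ Sxy → let m , my , m⊆↑y = minimalOpen {τ} A y
                                        in proj₂ (k≐ y) (m , (λ z mz → S-trans Sxy (≤⊆S (m⊆↑y z mz))) , my))

      ≤-upClosedOpens : ∀ {x y} → x ≤⟨ upClosedOpens τ S ⟩ y ⇔ S x y
      ≤-upClosedOpens {x} {y} = mk⇔ forth (λ Sxy (i , upᵢ) ix → upᵢ Sxy ix)
        where
        forth : x ≤⟨ upClosedOpens τ S ⟩ y → S x y
        forth x≤y with upset-∈τ x
        ... | k , k≐ = proj₁ (k≐ y) (x≤y (k , UpClosed-≐ k≐ (λ Syz Sxy → S-trans Sxy Syz))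
                                        (proj₂ (k≐ x) (≤⊆S (≤-refl {τ} x))))

  -- The Visser relation generated by R and S₁ on R-siblings

  data Step (R S₁ : Rel X 0ℓ) (y z : X) : Set where
    R-step       : R y z → Step R S₁ y z
    sibling-step : S₁ y z → Σ X (λ u → R u y × R u z) → Step R S₁ y z

  UpClosed-Step : ∀ {R S₁ U} → UpClosed R U → UpClosed S₁ U → UpClosed (Step R S₁) U
  UpClosed-Step upR upS₁ (R-step Ryz)         = upR Ryz
  UpClosed-Step upR upS₁ (sibling-step S₁yz _) = upS₁ S₁yz

  module _ {R S₁ : Rel X 0ℓ} (S₁-refl : ∀ y → S₁ y y) (S₁-trans : Transitive S₁)
           (R⊆S₁-on-successors : ∀ {x y w} → R x y → R y w → S₁ y w) where

    Star-Step⇒S₁ : ∀ {u y w} → R u y → Star (Step R S₁) y w → S₁ y w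
    Star-Step⇒S₁ _   ε =
      S₁-refl _
    Star-Step⇒S₁ uRy (R-step yRz ◅ steps) =
      S₁-trans (R⊆S₁-on-successors uRy yRz) (Star-Step⇒S₁ yRz steps)
    Star-Step⇒S₁ _   (sibling-step S₁yz (_ , _ , vRz) ◅ steps) =
      S₁-trans S₁yz (Star-Step⇒S₁ vRz steps)

    S₁⇔Star-Step-on-siblings : ∀ {x y z} → R x y → R x z → S₁ y z ⇔ Star (Step R S₁) y z
    S₁⇔Star-Step-on-siblings {x} xRy xRz =
      mk⇔ (λ S₁yz → sibling-step S₁yz (x , xRy , xRz) ◅ ε) (Star-Step⇒S₁ xRy)

module FromILSpace (em : ExcludedMiddle 0ℓ) {X : Set} {τ0 τ1 : Topology {X}}
                   (A0 : IsAlexandroff τ0) (A1 : IsAlexandroff τ1) (il : IsILSpace τ0 τ1) where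

  IL-valid : ∀ φ → IL φ → FrameLog (_<⟨ τ0 ⟩_) (_≤⟨ τ1 ⟩_) φ
  IL-valid φ ⊢φ = proj₁ (TopLog≐FrameLog em A0 A1 φ) (il φ ⊢φ)

  scattered : Scattered τ0
  scattered Y ∃Y =
    let x , Yx , no-successor = L-valid⇒R-maximal em {R = _<⟨ τ0 ⟩_} {S = _≤⟨ τ1 ⟩_} (IL-valid _ axL) Y ∃Y
    in x , Yx , no-successor ∘ d⇒< {τ = τ0} A0

  S : Rel X 0ℓ
  S = Star (Step (_<⟨ τ0 ⟩_) (_≤⟨ τ1 ⟩_))

  ≤⊆S : ∀ {x y} → x ≤⟨ τ0 ⟩ y → S x y
  ≤⊆S {x} {y} x≤y with em {y ≡ x}
  ... | yes refl = ε
  ... | no y≢x   = R-step (x≤y , y≢x) ◅ ε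

  <⊆S : ∀ x y → x <⟨ τ0 ⟩ y → S x y
  <⊆S _ _ x<y = R-step x<y ◅ ε

  visser : IsVisserFrame (_<⟨ τ0 ⟩_) S
  visser = scattered⇒VisserFrame {τ = τ0} scattered (λ _ → ε) _◅◅_

  ≤₁⇔S-on-siblings : ∀ {x y z} → x <⟨ τ0 ⟩ y → x <⟨ τ0 ⟩ z → y ≤⟨ τ1 ⟩ z ⇔ S y z
  ≤₁⇔S-on-siblings = S₁⇔Star-Step-on-siblings (≤-refl {τ = τ1}) (≤-trans {τ = τ1})
                       (J5-valid⇒R⊆S-on-successors (IL-valid _ axJ5))

  TopLog≐FrameLog-S : TopLog τ0 τ1 ≐ᴸ FrameLog (_<⟨ τ0 ⟩_) S
  TopLog≐FrameLog-S = ≐ᴸ-trans (TopLog≐FrameLog em A0 A1) (FrameLog-cong-S ≤₁⇔S-on-siblings)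

  τ2 : Topology {X}
  τ2 = upClosedOpens τ0 S

  τ2-Alexandroff : IsAlexandroff τ2
  τ2-Alexandroff = upClosedOpens-Alexandroff {τ = τ0} {S = S} A0

  τ0∩τ1⊆τ2 : ∀ U → U ∈τ τ0 → U ∈τ τ1 → U ∈τ τ2
  τ0∩τ1⊆τ2 U U∈τ0@(i , i≐U) U∈τ1 = (i , UpClosed-≐ i≐U (UpClosed-Star (UpClosed-Step up₀ up₁))) , i≐U
    where
    up₀ : UpClosed (_<⟨ τ0 ⟩_) U
    up₀ (y≤z , _) = ∈τ⇒UpClosed {τ = τ0} U∈τ0 y≤z
    up₁ : UpClosed (_≤⟨ τ1 ⟩_) U
    up₁ = ∈τ⇒UpClosed {τ = τ1} U∈τ1

  τ2⊆τ0 : ∀ U → U ∈τ τ2 → U ∈τ τ0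
  τ2⊆τ0 U ((i , _) , i≐U) = i , i≐U

  TopLog-τ1≐TopLog-τ2 : TopLog τ0 τ1 ≐ᴸ TopLog τ0 τ2
  TopLog-τ1≐TopLog-τ2 =
    ≐ᴸ-trans TopLog≐FrameLog-S
      (≐ᴸ-sym (≐ᴸ-trans (TopLog≐FrameLog em A0 τ2-Alexandroff)
                        (FrameLog-cong-S λ _ _ → ≤-upClosedOpens {τ = τ0} {S = S} A0 _◅◅_ ≤⊆S)))

scattered-coarsening⇒ILSpace : ExcludedMiddle 0ℓ → {X : Set} {τ0 τ1 τ2 : Topology {X}} →
                               IsAlexandroff τ0 → IsAlexandroff τ2 → Scattered τ0 →
                               (∀ U → U ∈τ τ2 → U ∈τ τ0) → TopLog τ0 τ1 ≐ᴸ TopLog τ0 τ2 → IsILSpace τ0 τ1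
scattered-coarsening⇒ILSpace em {τ0 = τ0} {τ2 = τ2} A0 A2 sc τ2⊆τ0 Log≐ φ ⊢φ =
  proj₂ (Log≐ φ) (proj₂ (TopLog≐FrameLog em A0 A2 φ) (IL-sound em visser <₀⊆≤₂ ⊢φ))
  where
  visser : IsVisserFrame (_<⟨ τ0 ⟩_) (_≤⟨ τ2 ⟩_)
  visser = scattered⇒VisserFrame {τ = τ0} sc (≤-refl {τ = τ2}) (≤-trans {τ = τ2})
  <₀⊆≤₂ : ∀ x y → x <⟨ τ0 ⟩ y → x ≤⟨ τ2 ⟩ y
  <₀⊆≤₂ _ _ (x≤y , _) = ≤-antitone {τ = τ0} {τ′ = τ2} τ2⊆τ0 x≤y

theorem5p6 : ExcludedMiddle 0ℓ → ExcludedMiddle (lsuc 0ℓ) →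
    {X : Set} → X → (τ0 τ1 : Topology {X}) →
    IsAlexandroff τ0 → IsAlexandroff τ1 →
    let P1 = IsILSpace τ0 τ1
        P2 = Scattered τ0 ×
             Σ (Topology {X}) (λ τ2 →
               IsAlexandroff τ2 ×
               (∀ U → U ∈τ τ0 → U ∈τ τ1 → U ∈τ τ2) ×
               (∀ U → U ∈τ τ2 → U ∈τ τ0) ×
               (TopLog τ0 τ1 ≐ᴸ TopLog τ0 τ2))
        P3 = Σ (X → X → Set) (λ R → Σ (X → X → Set) (λ S →
               IsVisserFrame R S × (∀ x y → R x y → S x y) ×
               (TopLog τ0 τ1 ≐ᴸ FrameLog R S)))
    in ((P1 → P2) × (P2 → P1)) × ((P1 → P3) × (P3 → P1))
-- Excluded middle for small types suffices.
theorem5p6 em _ _ τ0 τ1 A0 A1 =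
  ( (λ il → let open FromILSpace em A0 A1 il in
      scattered , τ2 , τ2-Alexandroff , τ0∩τ1⊆τ2 , τ2⊆τ0 , TopLog-τ1≐TopLog-τ2)
  , (λ (sc , _ , A2 , _ , τ2⊆τ0 , Log≐) → scattered-coarsening⇒ILSpace em A0 A2 sc τ2⊆τ0 Log≐) )
  , ( (λ il → let open FromILSpace em A0 A1 il in _<⟨ τ0 ⟩_ , S , visser , <⊆S , TopLog≐FrameLog-S)
    , (λ (_ , _ , visser , R⊆S , Log≐) φ ⊢φ → proj₂ (Log≐ φ) (IL-sound em visser R⊆S ⊢φ)) )
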